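{- Let $\mathcal{BIP}$ be the class of bipartite graphs. For all integers $k\ge 1$ and $i$ with $k+3\le i\le 2k+2$, we have $R_k^{\mathcal{BIP}}(i,k+2)=k+3$.
   Context: All graphs are finite and simple. For a graph $G$ and an integer $k\ge 0$, a set $S\subseteq V(G)$ is $k$-sparse if every vertex of $S$ has at most $k$ neighbours in $S$, and $k$-dense if every vertex of $S$ is non-adjacent to at most $k$ other vertices of $S$. A $k$-sparse (resp. $k$-dense) $j$-set is a $k$-sparse (resp. $k$-dense) set of exactly $j$ vertices. For a graph class $\mathcal{G}$, $R_k^{\mathcal{G}}(i,j)$ is the smallest $n$ such that every graph in $\mathcal{G}$ on $n$ vertices has a $k$-dense $i$-set or a $k$-sparse $j$-set. -}

module Defs where

open import Data.Nat using (ℕ; _≤_; _<_)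
open import Data.Bool using (Bool; true; false; not; _∧_)
open import Data.Fin using (Fin)
open import Data.Fin.Subset using (Subset; _∈_; _∩_; ∣_∣)
open import Data.Vec using (tabulate)
open import Data.Product using (Σ; _×_)
open import Relation.Nullary using (¬_; does)
open import Relation.Binary.PropositionalEquality using (_≡_; _≢_)
import Data.Fin as F

record Graph (n : ℕ) : Set where
  field
    adj   : Fin n → Fin n → Bool
    sym   : ∀ u v → adj u v ≡ adj v u
    irrefl : ∀ v → adj v v ≡ false
open Graph public

Bipartite : ∀ {n} → Graph n → Set
Bipartite {n} G = Σ (Fin n → Bool) λ c → ∀ u v → adj G u v ≡ true → c u ≢ c v

nbhd : ∀ {n} → Graph n → Fin n → Subset n
nbhd G v = tabulate (λ u → adj G v u)

nonNbhd : ∀ {n} → Graph n → Fin n → Subset n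
nonNbhd G v = tabulate (λ u → not (adj G v u) ∧ not (does (u F.≟ v)))

Sparse : ∀ {n} → Graph n → ℕ → Subset n → Set
Sparse G k S = ∀ v → v ∈ S → ∣ S ∩ nbhd G v ∣ ≤ k

Dense : ∀ {n} → Graph n → ℕ → Subset n → Set
Dense G k S = ∀ v → v ∈ S → ∣ S ∩ nonNbhd G v ∣ ≤ k

RamseyPropBIP : ℕ → ℕ → ℕ → ℕ → Set
RamseyPropBIP k i j n =
  (G : Graph n) → Bipartite G →
    (Σ (Subset n) λ S → ∣ S ∣ ≡ i × Dense G k S)
    Data.Sum.⊎
    (Σ (Subset n) λ S → ∣ S ∣ ≡ j × Sparse G k S)
  where import Data.Sum

IsRamseyBIP : ℕ → ℕ → ℕ → ℕ → Set
IsRamseyBIP k i j n = RamseyPropBIP k i j n × (∀ m → m < n → ¬ RamseyPropBIP k i j m)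

{-# OPTIONS --safe #-}
-- A (k+2)-subset of a (k+3)-vertex graph is V ∖ {v}, and it fails to be k-sparse exactly when
-- some u ≠ v is adjacent to every vertex other than u and v ("u covers v"). In a triangle-free
-- graph the vertices outside {u, v} are then independent, so a coverer of a coverer of v is v
-- itself; if every vertex is covered, a second mutually covering pair leaves no room for a fifth
-- vertex, and G is the 4-cycle, which is 1-dense. This rules out k ≥ 2 and settles k = 1, i = 4.
-- For the lower bound, the star on m ≤ k + 2 vertices has fewer than i vertices, and its only
-- candidate (k+2)-set is the whole vertex set, in which the centre has k + 1 neighbours.
module Submission where

open import Defs hiding (sym)
open import Data.Nat using (ℕ; suc; _≤_; _<_; _+_; _*_; _∸_; z≤n; s≤s)
open import Data.Nat.Properties
  using (≤-antisym; ≤-trans; <-≤-trans; ≮⇒≥; <⇒≱; +-comm; +-cancelʳ-≤; +-cancelʳ-≡;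
         +-∸-assoc; +-monoˡ-≤; +-suc; ≤-pred; n<1+n; module ≤-Reasoning)
open import Data.Bool using (Bool; true; false; _xor_)
import Data.Bool as Bool
open import Data.Bool.Properties using (¬-not; xor-comm; xor-same)
open import Data.Fin using (Fin; zero; suc; _≟_)
open import Data.Fin.Properties using (all?; any?; ¬∀⟶∃¬; pigeonhole; <⇒≢)
open import Data.Fin.Subset using (Subset; _∈_; _∉_; _∩_; ∣_∣; ⊤; ∁; ⁅_⁆; _⊆_; _-_)
open import Data.Fin.Subset.Properties
  using (p⊆q⇒∣p∣≤∣q∣; ∣p∩q∣≤∣q∣; ∣p∣≤n; ∣⊤∣≡n; ∣⁅x⁆∣≡1; ∣∁p∣≡n∸∣p∣; ∣p∣≡n⇒p≡⊤; ∈⊤; x∈⁅x⁆;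
         x∈p∩q⁻; x∈p∧x≢y⇒x∈p-y; x∈p⇒∣p-x∣<∣p∣; x∈∁p⇒x∉p; x∉p⇒x∈∁p; x∉⁅y⁆⇒x≢y; x≢y⇒x∉⁅y⁆;
         ∩-identityˡ)
open import Data.Vec using (Vec; []; _∷_; tabulate; lookup)
open import Data.Vec.Properties using (lookup∘tabulate; []=⇒lookup; tabulate-cong; tabulate∘lookup; lookup-replicate)
open import Data.Vec.Relation.Unary.All using (All; []; _∷_)
open import Data.Vec.Relation.Unary.All.Properties using (lookup⁻)
open import Data.Product using (∃; _×_; _,_; proj₁; proj₂)
open import Data.Sum using (_⊎_; inj₁; inj₂)
open import Data.Empty using (⊥; ⊥-elim)
open import Relation.Nullary using (¬_; Dec; yes; no; ¬?; contradiction)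
open import Relation.Nullary.Decidable using (_×-dec_; _→-dec_)
open import Relation.Binary.PropositionalEquality
  using (_≡_; _≢_; refl; sym; trans; cong; subst; ≢-sym; module ≡-Reasoning)

fresh : ∀ {m n} (xs : Vec (Fin n) m) → m < n → ∃ λ x → All (x ≢_) xs
fresh {m} {n} xs m<n with all? (λ x → any? (λ i → lookup xs i ≟ x))
... | yes listed =
  let a , b , a<b , sameIndex = pigeonhole m<n (λ x → proj₁ (listed x))
  in ⊥-elim (<⇒≢ a<b (trans (sym (proj₂ (listed a))) (trans (cong (lookup xs) sameIndex) (proj₂ (listed b)))))
... | no ¬listed =
  let x , unlisted = ¬∀⟶∃¬ n _ (λ x → any? (λ i → lookup xs i ≟ x)) ¬listed
  in x , lookup⁻ (λ i x≡xsᵢ → unlisted (i , sym x≡xsᵢ))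

∈-tabulate⁻ : ∀ {n} {f : Fin n → Bool} {x} → x ∈ tabulate f → f x ≡ true
∈-tabulate⁻ {f = f} {x} x∈ = trans (sym (lookup∘tabulate f x)) ([]=⇒lookup x∈)

∣∁⁅x⁆∣≡n∸1 : ∀ {n} (x : Fin n) → ∣ ∁ ⁅ x ⁆ ∣ ≡ n ∸ 1
∣∁⁅x⁆∣≡n∸1 {n} x = trans (∣∁p∣≡n∸∣p∣ ⁅ x ⁆) (cong (n ∸_) (∣⁅x⁆∣≡1 x))

2+∣p∩q∣≤∣p∣ : ∀ {n} {p q : Subset n} {x y} → x ≢ y → x ∈ p → y ∈ p → x ∉ q → y ∉ q →
  2 + ∣ p ∩ q ∣ ≤ ∣ p ∣
2+∣p∩q∣≤∣p∣ {p = p} {q} {x} {y} x≢y x∈p y∈p x∉q y∉q = begin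
  2 + ∣ p ∩ q ∣     ≤⟨ s≤s (s≤s (p⊆q⇒∣p∣≤∣q∣ p∩q⊆p-x-y)) ⟩
  2 + ∣ p - x - y ∣ ≤⟨ s≤s (x∈p⇒∣p-x∣<∣p∣ (x∈p∧x≢y⇒x∈p-y y∈p (≢-sym x≢y))) ⟩
  1 + ∣ p - x ∣     ≤⟨ x∈p⇒∣p-x∣<∣p∣ x∈p ⟩
  ∣ p ∣             ∎
  where
  open ≤-Reasoning
  p∩q⊆p-x-y : p ∩ q ⊆ p - x - y
  p∩q⊆p-x-y z∈p∩q =
    let z∈p , z∈q = x∈p∩q⁻ p q z∈p∩q
    in x∈p∧x≢y⇒x∈p-y (x∈p∧x≢y⇒x∈p-y z∈p λ { refl → x∉q z∈q }) λ { refl → y∉q z∈q }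

module _ {n : ℕ} (G : Graph n) where

  Covers : Fin n → Fin n → Set
  Covers u v = ∀ w → w ≢ u → w ≢ v → adj G u w ≡ true

  Uncovered : Fin n → Set
  Uncovered v = ∀ u → u ≢ v → ∃ λ w → w ≢ u × w ≢ v × adj G u w ≡ false

  TriangleFree : Set
  TriangleFree = ∀ {a b c} → adj G a b ≡ true → adj G b c ≡ true → adj G a c ≡ true → ⊥

  private
    coversAt? : ∀ u v w → Dec (w ≢ u → w ≢ v → adj G u w ≡ true)
    coversAt? u v w = ¬? (w ≟ u) →-dec (¬? (w ≟ v) →-dec (adj G u w Bool.≟ true))

  ¬covers⇒nonNeighbour : ∀ {u v} → ¬ Covers u v → ∃ λ w → w ≢ u × w ≢ v × adj G u w ≡ false
  ¬covers⇒nonNeighbour {u} {v} ¬cov with ¬∀⟶∃¬ n _ (coversAt? u v) ¬cov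
  ... | w , ¬covAt with w ≟ u | w ≟ v | adj G u w in u≁w
  ...   | yes w≡u | _       | _     = contradiction (λ w≢u _ → contradiction w≡u w≢u) ¬covAt
  ...   | no _    | yes w≡v | _     = contradiction (λ _ w≢v → contradiction w≡v w≢v) ¬covAt
  ...   | no _    | no _    | true  = contradiction (λ _ _ → refl) ¬covAt
  ...   | no w≢u  | no w≢v  | false = w , w≢u , w≢v , u≁w

  uncovered⊎covered : ∀ v → Uncovered v ⊎ ∃ λ u → u ≢ v × Covers u v
  uncovered⊎covered v with any? (λ u → ¬? (u ≟ v) ×-dec all? (coversAt? u v))
  ... | yes (u , u≢v , cov) = inj₂ (u , u≢v , cov)
  ... | no ¬∃ = inj₁ λ u u≢v → ¬covers⇒nonNeighbour (λ cov → ¬∃ (u , u≢v , cov))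

  nonAdjacent⇒∉nbhd : ∀ {u w} → adj G u w ≡ false → w ∉ nbhd G u
  nonAdjacent⇒∉nbhd u≁w w∈ with trans (sym (∈-tabulate⁻ w∈)) u≁w
  ... | ()

  sparse-if-nonNeighbours : ∀ {k} {S : Subset n} → ∣ S ∣ ≡ k + 2 →
    (∀ u → u ∈ S → ∃ λ w → w ∈ S × w ≢ u × adj G u w ≡ false) → Sparse G k S
  sparse-if-nonNeighbours {k} {S} ∣S∣≡k+2 nonNeighbour u u∈S =
    let w , w∈S , w≢u , u≁w = nonNeighbour u u∈S
    in +-cancelʳ-≤ 2 _ _ (begin
      ∣ S ∩ nbhd G u ∣ + 2  ≡⟨ +-comm _ 2 ⟩
      2 + ∣ S ∩ nbhd G u ∣  ≤⟨ 2+∣p∩q∣≤∣p∣ (≢-sym w≢u) u∈S w∈S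
                                 (nonAdjacent⇒∉nbhd (irrefl G u)) (nonAdjacent⇒∉nbhd u≁w) ⟩
      ∣ S ∣                 ≡⟨ ∣S∣≡k+2 ⟩
      k + 2                 ∎)
    where open ≤-Reasoning

  uncovered⇒sparse : ∀ {k v} → ∣ ∁ ⁅ v ⁆ ∣ ≡ k + 2 → Uncovered v → Sparse G k (∁ ⁅ v ⁆)
  uncovered⇒sparse size uncovered = sparse-if-nonNeighbours size λ u u∈ →
    let w , w≢u , w≢v , u≁w = uncovered u (x∉⁅y⁆⇒x≢y (x∈∁p⇒x∉p u∈))
    in w , x∉p⇒x∈∁p (x≢y⇒x∉⁅y⁆ w≢v) , w≢u , u≁w

  covers⇒nonNbhd⊆ : ∀ {w p} → Covers w p → nonNbhd G w ⊆ ⁅ p ⁆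
  covers⇒nonNbhd⊆ {w} {p} cov {z} z∈ with z ≟ p | z ≟ w | adj G w z in w~z | ∈-tabulate⁻ z∈
  ... | yes refl | _       | _     | _  = x∈⁅x⁆ z
  ... | no z≢p   | no z≢w  | false | _  = contradiction (trans (sym (cov z z≢w z≢p)) w~z) λ ()
  ... | no _     | yes _   | false | ()
  ... | no _     | _       | true  | ()

  dense-if-covers : ∀ {S : Subset n} → (∀ w → ∃ (Covers w)) → Dense G 1 S
  dense-if-covers {S} covers w _ =
    let p , cov = covers w
    in begin
      ∣ S ∩ nonNbhd G w ∣  ≤⟨ ∣p∩q∣≤∣q∣ S _ ⟩
      ∣ nonNbhd G w ∣      ≤⟨ p⊆q⇒∣p∣≤∣q∣ (covers⇒nonNbhd⊆ cov) ⟩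
      ∣ ⁅ p ⁆ ∣            ≡⟨ ∣⁅x⁆∣≡1 p ⟩
      1                    ∎
    where open ≤-Reasoning

  bipartite⇒triangleFree : Bipartite G → TriangleFree
  bipartite⇒triangleFree (_ , proper) {a} {b} {c} a~b b~c a~c =
    proper a c a~c (trans (¬-not (proper a b a~b)) (sym (¬-not (≢-sym (proper b c b~c)))))

  module _ (triangleFree : TriangleFree) where

    covers⇒independent : ∀ {u v a b} → Covers u v → a ≢ u → a ≢ v → b ≢ u → b ≢ v → adj G a b ≡ false
    covers⇒independent {u} {v} {a} {b} cov a≢u a≢v b≢u b≢v with adj G a b in a~b
    ... | false = refl
    ... | true  = ⊥-elim (triangleFree (trans (Graph.sym G a u) (cov a a≢u a≢v)) (cov b b≢u b≢v) a~b)

    coverer-of-coverer : ∀ {u v u′ w} → Covers u v → u′ ≢ u → Covers u′ u →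
      w ≢ v → w ≢ u → w ≢ u′ → u′ ≡ v
    coverer-of-coverer {u} {v} {u′} {w} cuv u′≢u cu′u w≢v w≢u w≢u′ with u′ ≟ v
    ... | yes u′≡v = u′≡v
    ... | no u′≢v  =
      contradiction (trans (sym (cu′u w w≢u′ w≢u)) (covers⇒independent cuv u′≢u u′≢v w≢u w≢v)) λ ()

    mutual-coverers⇒uncovered⊎dense : ∀ {u v} → 4 ≤ n → u ≢ v → Covers u v → Covers v u →
      (∃ λ w → Uncovered w) ⊎ (n ≡ 4 × Dense G 1 ⊤)
    mutual-coverers⇒uncovered⊎dense {u} {v} 4≤n u≢v cuv cvu
      with fresh (u ∷ v ∷ []) (≤-trans (s≤s (s≤s (s≤s z≤n))) 4≤n)
    ... | w , w≢u ∷ w≢v ∷ [] with uncovered⊎covered w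
    ...   | inj₁ uncovered = inj₁ (w , uncovered)
    ...   | inj₂ (x , x≢w , cxw) = inj₂ (n≡4 , dense-if-covers partner)
      where
      u≁v : adj G u v ≡ false
      u≁v with adj G u v in u~v
      ... | false = refl
      ... | true  = ⊥-elim (triangleFree u~v (cvu w w≢v w≢u) (cuv w w≢u w≢v))

      x≢u : x ≢ u
      x≢u refl = contradiction (trans (sym (cxw v (≢-sym u≢v) (λ { refl → w≢v refl }))) u≁v) λ ()

      x≢v : x ≢ v
      x≢v refl = contradiction (trans (sym (cxw u u≢v (λ { refl → w≢u refl })))
                                      (trans (Graph.sym G v u) u≁v)) λ ()

      no-fifth : ∀ y → y ≢ u → y ≢ v → y ≢ w → y ≢ x → ⊥
      no-fifth y y≢u y≢v y≢w y≢x =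
        contradiction (trans (sym (cxw y y≢x y≢w)) (covers⇒independent cuv x≢u x≢v y≢u y≢v)) λ ()

      ¬4<n : ¬ 4 < n
      ¬4<n 4<n with fresh (u ∷ v ∷ w ∷ x ∷ []) 4<n
      ... | y , y≢u ∷ y≢v ∷ y≢w ∷ y≢x ∷ [] = no-fifth y y≢u y≢v y≢w y≢x

      -- G is the 4-cycle u w v x.
      n≡4 : n ≡ 4
      n≡4 = ≤-antisym (≮⇒≥ ¬4<n) 4≤n

      cwx : Covers w x
      cwx z z≢w z≢x with z ≟ u | z ≟ v
      ... | yes refl | _        = trans (Graph.sym G w z) (cuv w w≢u w≢v)
      ... | no _     | yes refl = trans (Graph.sym G w z) (cvu w w≢v w≢u)
      ... | no z≢u   | no z≢v   = ⊥-elim (no-fifth z z≢u z≢v z≢w z≢x)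

      partner : ∀ y → ∃ (Covers y)
      partner y with y ≟ u | y ≟ v | y ≟ w | y ≟ x
      ... | yes refl | _        | _        | _        = v , cuv
      ... | no _     | yes refl | _        | _        = u , cvu
      ... | no _     | no _     | yes refl | _        = x , cwx
      ... | no _     | no _     | no _     | yes refl = w , cxw
      ... | no y≢u   | no y≢v   | no y≢w   | no y≢x   = ⊥-elim (no-fifth y y≢u y≢v y≢w y≢x)

    uncovered⊎dense : 4 ≤ n → (∃ λ w → Uncovered w) ⊎ (n ≡ 4 × Dense G 1 ⊤)
    uncovered⊎dense 4≤n with fresh [] (≤-trans (s≤s z≤n) 4≤n)
    ... | v , [] with uncovered⊎covered v
    ...   | inj₁ uncovered = inj₁ (v , uncovered)
    ...   | inj₂ (u , u≢v , cuv) with uncovered⊎covered u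
    ...     | inj₁ uncovered = inj₁ (u , uncovered)
    ...     | inj₂ (u′ , u′≢u , cu′u) with fresh (v ∷ u ∷ u′ ∷ []) 4≤n
    ...       | w , w≢v ∷ w≢u ∷ w≢u′ ∷ [] =
      mutual-coverers⇒uncovered⊎dense 4≤n u≢v cuv
        (subst (λ z → Covers z u) (coverer-of-coverer cuv u′≢u cu′u w≢v w≢u w≢u′) cu′u)

completeBipartite : ∀ {m} → (Fin m → Bool) → Graph m
completeBipartite colour = record
  { adj    = λ u v → colour u xor colour v
  ; sym    = λ u v → xor-comm (colour u) (colour v)
  ; irrefl = λ v → xor-same (colour v)
  }

completeBipartite-bipartite : ∀ {m} (colour : Fin m → Bool) → Bipartite (completeBipartite colour)
completeBipartite-bipartite colour = colour , proper
  where
  proper : ∀ u v → colour u xor colour v ≡ true → colour u ≢ colour v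
  proper u v u~v same =
    contradiction (trans (sym (trans (cong (_xor colour v) same) (xor-same (colour v)))) u~v) λ ()

isCentre : ∀ {m} → Fin m → Bool
isCentre zero    = true
isCentre (suc _) = false

star : ∀ m → Graph m
star m = completeBipartite (isCentre {m})

centre-degree : ∀ m → ∣ ⊤ ∩ nbhd (star (suc m)) zero ∣ ≡ m
centre-degree m = begin
  ∣ ⊤ ∩ allTrue ∣  ≡⟨ cong ∣_∣ (∩-identityˡ allTrue) ⟩
  ∣ allTrue ∣      ≡⟨ cong ∣_∣ allTrue≡⊤ ⟩
  ∣ ⊤ {m} ∣        ≡⟨ ∣⊤∣≡n m ⟩
  m                ∎
  where
  open ≡-Reasoning
  allTrue : Subset m
  allTrue = tabulate (λ _ → true)
  allTrue≡⊤ : allTrue ≡ ⊤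
  allTrue≡⊤ = trans (tabulate-cong (λ i → sym (lookup-replicate i true))) (tabulate∘lookup ⊤)

full-star-not-sparse : ∀ {k m} → k < m → ¬ Sparse (star (suc m)) k ⊤
full-star-not-sparse {k} {m} k<m sparse = <⇒≱ k<m (subst (_≤ k) (centre-degree m) (sparse zero ∈⊤))

star-not-sparse : ∀ {k m} → m ≤ k + 2 → (S : Subset m) → ∣ S ∣ ≡ k + 2 → ¬ Sparse (star m) k S
star-not-sparse {k} {m} m≤k+2 S ∣S∣≡k+2
  with refl ← trans (≤-antisym m≤k+2 (subst (_≤ m) ∣S∣≡k+2 (∣p∣≤n S))) (+-comm k 2)
  with refl ← ∣p∣≡n⇒p≡⊤ {p = S} (trans ∣S∣≡k+2 (+-comm k 2))
  = full-star-not-sparse (n<1+n k)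

small-graphs-fail : ∀ {k i m} → k + 3 ≤ i → m < k + 3 → ¬ RamseyPropBIP k i (k + 2) m
small-graphs-fail {k} {m = m} k+3≤i m<k+3 ramsey with ramsey (star m) (completeBipartite-bipartite isCentre)
... | inj₁ (S , ∣S∣≡i , _) = <⇒≱ (<-≤-trans m<k+3 k+3≤i) (subst (_≤ m) ∣S∣≡i (∣p∣≤n S))
... | inj₂ (S , ∣S∣≡k+2 , sparse) =
  star-not-sparse (≤-pred (subst (m <_) (+-suc k 2) m<k+3)) S ∣S∣≡k+2 sparse

bipartite-upper-bound : ∀ {k i} → 1 ≤ k → k + 3 ≤ i → i ≤ 2 * k + 2 → RamseyPropBIP k i (k + 2) (k + 3)
bipartite-upper-bound {k} 1≤k k+3≤i i≤2k+2 G bipartite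
  with uncovered⊎dense G (bipartite⇒triangleFree G bipartite) (+-monoˡ-≤ 3 1≤k)
... | inj₁ (v , uncovered) =
  let size = trans (∣∁⁅x⁆∣≡n∸1 v) (+-∸-assoc k (s≤s z≤n))
  in inj₂ (∁ ⁅ v ⁆ , size , uncovered⇒sparse G size uncovered)
... | inj₂ (k+3≡4 , dense) with refl ← +-cancelʳ-≡ 3 k 1 k+3≡4 =
  inj₁ (⊤ , trans (∣⊤∣≡n 4) (≤-antisym k+3≤i i≤2k+2) , dense)

theorem4p4 : (k i : ℕ) → 1 ≤ k → k + 3 ≤ i → i ≤ 2 * k + 2 →
    IsRamseyBIP k i (k + 2) (k + 3)
theorem4p4 k i 1≤k k+3≤i i≤2k+2 =
  bipartite-upper-bound 1≤k k+3≤i i≤2k+2 , λ m m<k+3 → small-graphs-fail k+3≤i m<k+3
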